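{- Let $K$ be a $^*$-continuous KAT with top, $A$ a top Kleene abstract domain of $K$ with maps $\alpha,\gamma$, and $T_{\Sigma,B}$ a KAT language interpreted on $K$. For every $t\in T_{\Sigma,B}$ and $a\in K$: if $A$ is globally complete for $\llbracket\mathtt b\rrbracket_u$ for every atom $\mathtt b$ occurring in $t$, then $\mathcal S^\sharp[t]\,\alpha(\top a)=\alpha(\top a\llbracket t\rrbracket_u)$.
   Context: Idempotent semiring: $(K,+,0)$ commutative monoid with $a+a=a$, $(K,\cdot,1)$ monoid, two-sided distributivity, $0a=a0=0$; $a\le b$ iff $a+b=b$. KAT: idempotent semiring with Boolean subalgebra $\mathrm{Test}(K)$ (join $+$, meet $\cdot$, complement, bottom $0$, top $1$) and ${}^*$ with $1+aa^*\le a^*$, $1+a^*a\le a^*$, $b+ac\le c\Rightarrow a^*b\le c$, $b+ca\le c\Rightarrow ba^*\le c$. TopKAT: KAT with greatest element $\top$; $^*$-continuous: $\bigvee_nab^nc$ exists and equals $ab^*c$ for all $a,b,c$. $\mathrm{TOP}(K)=\{\top a\mid a\in K\}$. Language: disjoint $\Sigma,B$ ($\mathtt0,\mathtt1\in B$), $\mathrm{Atom}=\Sigma\cup B$, terms $t::=\mathtt a\mid\mathtt0\mid\mathtt1\mid t_1+t_2\mid t_1\cdot t_2\mid t^*$; evaluation $u:\mathrm{Atom}\to K$ with $u(B)\subseteq\mathrm{Test}(K)$ extended homomorphically to $\llbracket\cdot\rrbracket_u$. Top Kleene abstract domain: poset $A$, Galois insertion $\alpha:\mathrm{TOP}(K)\to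 A$, $\gamma:A\to\mathrm{TOP}(K)$ ($\alpha(x)\le_Ay\iff x\le\gamma(y)$, $\alpha\gamma=\mathrm{id}$), countably complete. Abstract semantics: $\mathcal S^\sharp[\mathtt c]x=\alpha(\gamma(x)\llbracket\mathtt c\rrbracket_u)$, $\mathcal S^\sharp[t_1+t_2]x=\mathcal S^\sharp[t_1]x\vee_A\mathcal S^\sharp[t_2]x$, $\mathcal S^\sharp[t_1\cdot t_2]x=\mathcal S^\sharp[t_2](\mathcal S^\sharp[t_1]x)$, $\mathcal S^\sharp[t^*]x=\bigvee_n(\mathcal S^\sharp[t])^nx$. With $A(x):=\gamma\alpha(x)$ for $x\in\mathrm{TOP}(K)$, $A$ is globally complete for $c\in K$ iff $A(\top bc)=A(A(\top b)c)$ for every $b\in K$. -}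

module Defs where

open import Level using (Level; _⊔_) renaming (suc to lsuc)
open import Data.Nat using (ℕ; zero; suc)
open import Data.Product using (Σ; ∃; _×_; _,_)
open import Data.Sum using (_⊎_; inj₁; inj₂)
open import Relation.Binary.PropositionalEquality using (_≡_)
open import Relation.Binary.Bundles using (Poset)

record KAT (c ℓ : Level) : Set (lsuc (c ⊔ ℓ)) where
  infixl 6 _+_
  infixl 7 _·_
  infix  8 _*
  infix  4 _≤_
  field
    Carrier : Set c
    _+_ _·_ : Carrier → Carrier → Carrier
    0# 1#   : Carrier
    _*      : Carrier → Carrier
    isTest  : Carrier → Set ℓ
    neg     : Carrier → Carrier   -- complement on tests

  _≤_ : Carrier → Carrier → Set c
  a ≤ b = a + b ≡ b

  field
    +-assoc     : ∀ a b c → (a + b) + c ≡ a + (b + c)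
    +-comm      : ∀ a b → a + b ≡ b + a
    +-identityˡ : ∀ a → 0# + a ≡ a
    +-identityʳ : ∀ a → a + 0# ≡ a
    +-idem      : ∀ a → a + a ≡ a
    ·-assoc     : ∀ a b c → (a · b) · c ≡ a · (b · c)
    ·-identityˡ : ∀ a → 1# · a ≡ a
    ·-identityʳ : ∀ a → a · 1# ≡ a
    distribˡ    : ∀ a b c → a · (b + c) ≡ a · b + a · c
    distribʳ    : ∀ a b c → (b + c) · a ≡ b · a + c · a
    zeroˡ       : ∀ a → 0# · a ≡ 0#
    zeroʳ       : ∀ a → a · 0# ≡ 0#
    test-0      : isTest 0#
    test-1      : isTest 1#
    test-+      : ∀ {b c} → isTest b → isTest c → isTest (b + c)
    test-·      : ∀ {b c} → isTest b → isTest c → isTest (b · c)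
    test-neg    : ∀ {b} → isTest b → isTest (neg b)
    test-·-comm : ∀ {b c} → isTest b → isTest c → b · c ≡ c · b
    test-·-idem : ∀ {b} → isTest b → b · b ≡ b
    test-absorb₁ : ∀ {b c} → isTest b → isTest c → b + b · c ≡ b
    test-absorb₂ : ∀ {b c} → isTest b → isTest c → b · (b + c) ≡ b
    test-+-distrib : ∀ {b c d} → isTest b → isTest c → isTest d →
                     b + c · d ≡ (b + c) · (b + d)
    test-top    : ∀ {b} → isTest b → b ≤ 1#
    test-bot    : ∀ {b} → isTest b → 0# ≤ b
    test-compl₁ : ∀ {b} → isTest b → b + neg b ≡ 1#
    test-compl₂ : ∀ {b} → isTest b → b · neg b ≡ 0#
    *-unfoldˡ   : ∀ a → 1# + a · a * ≤ a *
    *-unfoldʳ   : ∀ a → 1# + a * · a ≤ a *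
    *-inductˡ   : ∀ a b c → b + a · c ≤ c → a * · b ≤ c
    *-inductʳ   : ∀ a b c → b + c · a ≤ c → b · a * ≤ c

  _^_ : Carrier → ℕ → Carrier
  b ^ zero  = 1#
  b ^ suc n = b · (b ^ n)

record TopKAT (c ℓ : Level) : Set (lsuc (c ⊔ ℓ)) where
  field
    kat : KAT c ℓ
  open KAT kat public
  field
    ⊤     : Carrier
    ⊤-max : ∀ a → a ≤ ⊤

  InTOP : Carrier → Set c
  InTOP x = ∃ λ a → x ≡ ⊤ · a

IsLUB : ∀ {a r} {X : Set a} (_≤_ : X → X → Set r) → (ℕ → X) → X → Set (a ⊔ r)
IsLUB _≤_ f s = (∀ n → f n ≤ s) × (∀ u → (∀ n → f n ≤ u) → s ≤ u)

StarContinuous : ∀ {c ℓ} → TopKAT c ℓ → Set c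
StarContinuous K = ∀ a b c → IsLUB _≤_ (λ n → a · (b ^ n) · c) (a · b * · c)
  where open TopKAT K

record TopKleeneAbsDomain {c ℓ} (K : TopKAT c ℓ) (a ℓ₁ ℓ₂ : Level)
       : Set (lsuc (c ⊔ ℓ ⊔ a ⊔ ℓ₁ ⊔ ℓ₂)) where
  open TopKAT K using (Carrier; InTOP) renaming (_≤_ to _≤K_)
  field
    poset : Poset a ℓ₁ ℓ₂
  open Poset poset renaming (Carrier to Abs; _≤_ to _⊑_)
  field
    -- α : TOP(K) → A is represented by a map on K; only its values on TOP(K) are constrained/used
    α         : Carrier → Abs
    γ         : Abs → Carrier
    γ-TOP     : ∀ y → InTOP (γ y)
    galois    : ∀ x → InTOP x → ∀ y → (α x ⊑ y → x ≤K γ y) × (x ≤K γ y → α x ⊑ y)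
    insertion : ∀ y → α (γ y) ≈ y
    -- countable completeness: binary joins and joins of ℕ-indexed families
    _∨_       : Abs → Abs → Abs
    ∨-lub     : ∀ x y → (x ⊑ (x ∨ y)) × (y ⊑ (x ∨ y))
                        × (∀ z → x ⊑ z → y ⊑ z → (x ∨ y) ⊑ z)
    ⋁         : (ℕ → Abs) → Abs
    ⋁-lub     : ∀ f → IsLUB _⊑_ f (⋁ f)

  Aᶜ : Carrier → Carrier
  Aᶜ x = γ (α x)

Atom : ∀ {s} → Set s → Set s → Set s
Atom Σ′ B = Σ′ ⊎ B

data Term {s} (Σ′ B : Set s) : Set s where
  atom      : Atom Σ′ B → Term Σ′ B
  𝟘 𝟙       : Term Σ′ B
  _⊕_ _⊗_   : Term Σ′ B → Term Σ′ B → Term Σ′ B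
  _⊛        : Term Σ′ B → Term Σ′ B

data Occurs {s} {Σ′ B : Set s} (b : Atom Σ′ B) : Term Σ′ B → Set s where
  here  : Occurs b (atom b)
  ⊕ˡ    : ∀ {t₁ t₂} → Occurs b t₁ → Occurs b (t₁ ⊕ t₂)
  ⊕ʳ    : ∀ {t₁ t₂} → Occurs b t₂ → Occurs b (t₁ ⊕ t₂)
  ⊗ˡ    : ∀ {t₁ t₂} → Occurs b t₁ → Occurs b (t₁ ⊗ t₂)
  ⊗ʳ    : ∀ {t₁ t₂} → Occurs b t₂ → Occurs b (t₁ ⊗ t₂)
  ⊛′    : ∀ {t} → Occurs b t → Occurs b (t ⊛)

module _ {c ℓ} (K : TopKAT c ℓ) where
  open TopKAT K

  IsInterpretation : ∀ {s} {Σ′ B : Set s} → (Atom Σ′ B → Carrier) → Set (s ⊔ ℓ)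
  IsInterpretation {B = B} u = ∀ (b : B) → isTest (u (inj₂ b))

  ⟦_⟧ : ∀ {s} {Σ′ B : Set s} → Term Σ′ B → (Atom Σ′ B → Carrier) → Carrier
  ⟦ atom b ⟧  u = u b
  ⟦ 𝟘 ⟧       u = 0#
  ⟦ 𝟙 ⟧       u = 1#
  ⟦ t₁ ⊕ t₂ ⟧ u = ⟦ t₁ ⟧ u + ⟦ t₂ ⟧ u
  ⟦ t₁ ⊗ t₂ ⟧ u = ⟦ t₁ ⟧ u · ⟦ t₂ ⟧ u
  ⟦ t ⊛ ⟧     u = (⟦ t ⟧ u) *

  module _ {a ℓ₁ ℓ₂} (D : TopKleeneAbsDomain K a ℓ₁ ℓ₂) where
    open TopKleeneAbsDomain D
    open Poset poset renaming (Carrier to Abs)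

    GloballyComplete : Carrier → Set c
    GloballyComplete k = ∀ b → Aᶜ (⊤ · b · k) ≡ Aᶜ (Aᶜ (⊤ · b) · k)

    iter : (Abs → Abs) → ℕ → Abs → Abs
    iter f zero    x = x
    iter f (suc n) x = f (iter f n x)

    S♯ : ∀ {s} {Σ′ B : Set s} → (Atom Σ′ B → Carrier) → Term Σ′ B → Abs → Abs
    S♯ u (atom b)  x = α (γ x · u b)
    S♯ u 𝟘         x = α (γ x · 0#)
    S♯ u 𝟙         x = α (γ x · 1#)
    S♯ u (t₁ ⊕ t₂) x = S♯ u t₁ x ∨ S♯ u t₂ x
    S♯ u (t₁ ⊗ t₂) x = S♯ u t₂ (S♯ u t₁ x)
    S♯ u (t ⊛)     x = ⋁ (λ n → iter (S♯ u t) n x)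

{-# OPTIONS --safe #-}
module Submission where

-- On TOP(K), α is the left adjoint of a Galois insertion, so it preserves every
-- join that exists there, in particular ⊤x·t₁ + ⊤x·t₂ and, by *-continuity,
-- ⊤x·t* = ⋁ₙ ⊤x·tⁿ.  Hence sums and stars commute with abstraction, products
-- compose, and at an atom b global completeness gives
-- α(A(⊤x)·b) = α(A(A(⊤x)·b)) = α(A(⊤x·b)) = α(⊤x·b).

open import Defs
open import Level using (_⊔_)
open import Relation.Binary.Bundles using (Poset)
open import Data.Nat using (ℕ; zero; suc)
open import Data.Product using (_,_; proj₁; proj₂)
open import Function using (_∘_)
open import Relation.Binary.PropositionalEquality as ≡
  using (_≡_; refl; cong; subst; subst₂)

module TopKATProperties {c ℓ} (K : TopKAT c ℓ) where
  open TopKAT K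

  ≤-antisym : ∀ {x y} → x ≤ y → y ≤ x → x ≡ y
  ≤-antisym {x} {y} x≤y y≤x = ≡.trans (≡.sym y≤x) (≡.trans (+-comm y x) x≤y)

  ≤-trans : ∀ {x y z} → x ≤ y → y ≤ z → x ≤ z
  ≤-trans {x} {y} {z} x≤y y≤z = begin
    x + z        ≡⟨ cong (x +_) (≡.sym y≤z) ⟩
    x + (y + z)  ≡⟨ ≡.sym (+-assoc x y z) ⟩
    (x + y) + z  ≡⟨ cong (_+ z) x≤y ⟩
    y + z        ≡⟨ y≤z ⟩
    z            ∎
    where open ≡.≡-Reasoning

  +-least : ∀ {x y z} → x ≤ z → y ≤ z → x + y ≤ z
  +-least {x} {y} {z} x≤z y≤z =
    ≡.trans (+-assoc x y z) (≡.trans (cong (x +_) y≤z) x≤z)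

  x≤x+y : ∀ x y → x ≤ x + y
  x≤x+y x y = ≡.trans (≡.sym (+-assoc x x y)) (cong (_+ y) (+-idem x))

  y≤x+y : ∀ x y → y ≤ x + y
  y≤x+y x y = subst (y ≤_) (+-comm y x) (x≤x+y y x)

  ^-sucʳ : ∀ b n → b ^ suc n ≡ b ^ n · b
  ^-sucʳ b zero    = ≡.trans (·-identityʳ b) (≡.sym (·-identityˡ b))
  ^-sucʳ b (suc n) = ≡.trans (cong (b ·_) (^-sucʳ b n)) (≡.sym (·-assoc b (b ^ n) b))

  ·-InTOP : ∀ {x} → InTOP x → ∀ k → InTOP (x · k)
  ·-InTOP (a , refl) k = a · k , ·-assoc ⊤ a k

  +-InTOP : ∀ {x y} → InTOP x → InTOP y → InTOP (x + y)
  +-InTOP (a , refl) (b , refl) = a + b , ≡.sym (distribˡ ⊤ a b)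

  ⊤·-InTOP : ∀ x → InTOP (⊤ · x)
  ⊤·-InTOP x = x , refl

  *-lub : StarContinuous K → ∀ a b → IsLUB _≤_ (λ n → a · b ^ n) (a · b *)
  *-lub sc a b =
      (λ n → subst₂ _≤_ (·-identityʳ _) (·-identityʳ _) (proj₁ lub n))
    , (λ z ub → subst (_≤ z) (·-identityʳ _)
                  (proj₂ lub z (λ n → subst (_≤ z) (≡.sym (·-identityʳ _)) (ub n))))
    where lub = sc a b 1#

module GaloisInsertionProperties {c ℓ a ℓ₁ ℓ₂} {K : TopKAT c ℓ}
                                 (D : TopKleeneAbsDomain K a ℓ₁ ℓ₂) where
  open TopKAT K
  open TopKATProperties K
  open TopKleeneAbsDomain D
  open Poset poset
    renaming (Carrier to Abs; _≤_ to _⊑_; refl to ⊑-refl; trans to ⊑-trans)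

  ≤-γα : ∀ {x} → InTOP x → x ≤ γ (α x)
  ≤-γα {x} x∈TOP = proj₁ (galois x x∈TOP (α x)) ⊑-refl

  α-mono : ∀ {x y} → InTOP x → InTOP y → x ≤ y → α x ⊑ α y
  α-mono {x} x∈TOP y∈TOP x≤y = proj₂ (galois x x∈TOP _) (≤-trans x≤y (≤-γα y∈TOP))

  γ-mono : ∀ {y z} → y ⊑ z → γ y ≤ γ z
  γ-mono {y} y⊑z = proj₁ (galois (γ y) (γ-TOP y) _) (⊑-trans (reflexive (insertion y)) y⊑z)

  γ-cong : ∀ {y z} → y ≈ z → γ y ≡ γ z
  γ-cong y≈z = ≤-antisym (γ-mono (reflexive y≈z)) (γ-mono (reflexive (Eq.sym y≈z)))

  ∨-least : ∀ {x y z} → x ⊑ z → y ⊑ z → (x ∨ y) ⊑ z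
  ∨-least x⊑z y⊑z = proj₂ (proj₂ (∨-lub _ _)) _ x⊑z y⊑z

  ∨-cong : ∀ {x y x′ y′} → x ≈ x′ → y ≈ y′ → (x ∨ y) ≈ (x′ ∨ y′)
  ∨-cong {x} {y} {x′} {y′} x≈x′ y≈y′ = antisym
    (∨-least (⊑-trans (reflexive x≈x′) (proj₁ (∨-lub x′ y′)))
             (⊑-trans (reflexive y≈y′) (proj₁ (proj₂ (∨-lub x′ y′)))))
    (∨-least (⊑-trans (reflexive (Eq.sym x≈x′)) (proj₁ (∨-lub x y)))
             (⊑-trans (reflexive (Eq.sym y≈y′)) (proj₁ (proj₂ (∨-lub x y)))))

  ⋁-cong : ∀ {f g} → (∀ n → f n ≈ g n) → ⋁ f ≈ ⋁ g
  ⋁-cong {f} {g} f≈g = antisym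
    (proj₂ (⋁-lub f) _ (λ n → ⊑-trans (reflexive (f≈g n)) (proj₁ (⋁-lub g) n)))
    (proj₂ (⋁-lub g) _ (λ n → ⊑-trans (reflexive (Eq.sym (f≈g n))) (proj₁ (⋁-lub f) n)))

  α-+ : ∀ {x y} → InTOP x → InTOP y → α (x + y) ≈ (α x ∨ α y)
  α-+ {x} {y} x∈TOP y∈TOP = antisym
    (proj₂ (galois _ x+y∈TOP _)
      (+-least (proj₁ (galois x x∈TOP _) (proj₁ (∨-lub (α x) (α y))))
               (proj₁ (galois y y∈TOP _) (proj₁ (proj₂ (∨-lub (α x) (α y)))))))
    (∨-least (α-mono x∈TOP x+y∈TOP (x≤x+y x y)) (α-mono y∈TOP x+y∈TOP (y≤x+y x y)))
    where x+y∈TOP = +-InTOP x∈TOP y∈TOP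

  α-⋁ : ∀ {f s} → (∀ n → InTOP (f n)) → InTOP s → IsLUB _≤_ f s →
        α s ≈ ⋁ (λ n → α (f n))
  α-⋁ {f} {s} f∈TOP s∈TOP (ub , least) = antisym
    (proj₂ (galois s s∈TOP _)
      (least _ (λ n → proj₁ (galois (f n) (f∈TOP n) _) (proj₁ (⋁-lub _) n))))
    (proj₂ (⋁-lub _) _ (λ n → α-mono (f∈TOP n) s∈TOP (ub n)))

  α-γα-complete : ∀ {k} → GloballyComplete K D k → ∀ x →
                  α (γ (α (⊤ · x)) · k) ≈ α (⊤ · x · k)
  α-γα-complete {k} complete x = begin
    α (Aᶜ (⊤ · x) · k)       ≈⟨ insertion _ ⟨
    α (Aᶜ (Aᶜ (⊤ · x) · k))  ≡⟨ cong α (complete x) ⟨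
    α (Aᶜ (⊤ · x · k))       ≈⟨ insertion _ ⟩
    α (⊤ · x · k)            ∎
    where open import Relation.Binary.Reasoning.Setoid Eq.setoid

module AbstractSemantics {c ℓ a ℓ₁ ℓ₂ s} {K : TopKAT c ℓ} (sc : StarContinuous K)
                         (D : TopKleeneAbsDomain K a ℓ₁ ℓ₂)
                         {Σ′ B : Set s} (u : Atom Σ′ B → TopKAT.Carrier K) where
  open TopKAT K
  open TopKATProperties K
  open TopKleeneAbsDomain D
  open Poset poset using (_≈_; module Eq)
  open GaloisInsertionProperties D
  open import Relation.Binary.Reasoning.Setoid Eq.setoid

  iter-cong : ∀ {f} → (∀ {y z} → y ≈ z → f y ≈ f z) →
              ∀ n {y z} → y ≈ z → iter K D f n y ≈ iter K D f n z
  iter-cong f-cong zero    y≈z = y≈z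
  iter-cong f-cong (suc n) y≈z = f-cong (iter-cong f-cong n y≈z)

  S♯-cong : ∀ t {y z} → y ≈ z → S♯ K D u t y ≈ S♯ K D u t z
  S♯-cong (atom b)  y≈z = Eq.reflexive (cong (λ w → α (w · u b)) (γ-cong y≈z))
  S♯-cong 𝟘         y≈z = Eq.reflexive (cong (λ w → α (w · 0#)) (γ-cong y≈z))
  S♯-cong 𝟙         y≈z = Eq.reflexive (cong (λ w → α (w · 1#)) (γ-cong y≈z))
  S♯-cong (t₁ ⊕ t₂) y≈z = ∨-cong (S♯-cong t₁ y≈z) (S♯-cong t₂ y≈z)
  S♯-cong (t₁ ⊗ t₂) y≈z = S♯-cong t₂ (S♯-cong t₁ y≈z)
  S♯-cong (t ⊛)     y≈z = ⋁-cong (λ n → iter-cong (S♯-cong t) n y≈z)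

  CompleteFor : Term Σ′ B → Set (s ⊔ c)
  CompleteFor t = ∀ b → Occurs b t → GloballyComplete K D (u b)

  S♯-α-⊤ : ∀ t → CompleteFor t → ∀ x →
           S♯ K D u t (α (⊤ · x)) ≈ α (⊤ · x · ⟦_⟧ K t u)
  S♯-α-⊤ (atom b) complete x = α-γα-complete (complete b here) x
  S♯-α-⊤ 𝟘 complete x = Eq.reflexive (cong α (≡.trans (zeroʳ _) (≡.sym (zeroʳ _))))
  S♯-α-⊤ 𝟙 complete x = begin
    α (γ (α (⊤ · x)) · 1#)  ≡⟨ cong α (·-identityʳ _) ⟩
    α (γ (α (⊤ · x)))       ≈⟨ insertion _ ⟩
    α (⊤ · x)               ≡⟨ cong α (·-identityʳ _) ⟨
    α (⊤ · x · 1#)          ∎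
  S♯-α-⊤ (t₁ ⊕ t₂) complete x = begin
    S♯ K D u t₁ (α (⊤ · x)) ∨ S♯ K D u t₂ (α (⊤ · x))
      ≈⟨ ∨-cong (S♯-α-⊤ t₁ (λ b → complete b ∘ ⊕ˡ) x) (S♯-α-⊤ t₂ (λ b → complete b ∘ ⊕ʳ) x) ⟩
    α (⊤ · x · T₁) ∨ α (⊤ · x · T₂)
      ≈⟨ α-+ (·-InTOP (⊤·-InTOP x) T₁) (·-InTOP (⊤·-InTOP x) T₂) ⟨
    α (⊤ · x · T₁ + ⊤ · x · T₂)
      ≡⟨ cong α (distribˡ (⊤ · x) T₁ T₂) ⟨
    α (⊤ · x · (T₁ + T₂))  ∎
    where T₁ = ⟦_⟧ K t₁ u
          T₂ = ⟦_⟧ K t₂ u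
  S♯-α-⊤ (t₁ ⊗ t₂) complete x = begin
    S♯ K D u t₂ (S♯ K D u t₁ (α (⊤ · x)))
      ≈⟨ S♯-cong t₂ (S♯-α-⊤ t₁ (λ b → complete b ∘ ⊗ˡ) x) ⟩
    S♯ K D u t₂ (α (⊤ · x · T₁))
      ≡⟨ cong (S♯ K D u t₂ ∘ α) (·-assoc ⊤ x T₁) ⟩
    S♯ K D u t₂ (α (⊤ · (x · T₁)))
      ≈⟨ S♯-α-⊤ t₂ (λ b → complete b ∘ ⊗ʳ) (x · T₁) ⟩
    α (⊤ · (x · T₁) · T₂)
      ≡⟨ cong α (≡.trans (cong (_· T₂) (≡.sym (·-assoc ⊤ x T₁))) (·-assoc (⊤ · x) T₁ T₂)) ⟩
    α (⊤ · x · (T₁ · T₂))  ∎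
    where T₁ = ⟦_⟧ K t₁ u
          T₂ = ⟦_⟧ K t₂ u
  S♯-α-⊤ (t ⊛) complete x = begin
    ⋁ (λ n → iter K D (S♯ K D u t) n (α (⊤ · x)))  ≈⟨ ⋁-cong iterates ⟩
    ⋁ (λ n → α (⊤ · x · T ^ n))                     ≈⟨ α-⋁ (λ n → ·-InTOP (⊤·-InTOP x) (T ^ n))
                                                           (·-InTOP (⊤·-InTOP x) (T *))
                                                           (*-lub sc (⊤ · x) T) ⟨
    α (⊤ · x · T *)                                 ∎
    where
    T = ⟦_⟧ K t u
    iterates : ∀ n → iter K D (S♯ K D u t) n (α (⊤ · x)) ≈ α (⊤ · x · T ^ n)
    iterates zero    = Eq.reflexive (cong α (≡.sym (·-identityʳ _)))
    iterates (suc n) = begin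
      S♯ K D u t (iter K D (S♯ K D u t) n (α (⊤ · x)))
        ≈⟨ S♯-cong t (iterates n) ⟩
      S♯ K D u t (α (⊤ · x · T ^ n))
        ≡⟨ cong (S♯ K D u t ∘ α) (·-assoc ⊤ x (T ^ n)) ⟩
      S♯ K D u t (α (⊤ · (x · T ^ n)))
        ≈⟨ S♯-α-⊤ t (λ b → complete b ∘ ⊛′) (x · T ^ n) ⟩
      α (⊤ · (x · T ^ n) · T)
        ≡⟨ cong α (≡.trans (cong (_· T) (≡.sym (·-assoc ⊤ x (T ^ n))))
                  (≡.trans (·-assoc (⊤ · x) (T ^ n) T) (cong (⊤ · x ·_) (≡.sym (^-sucʳ T n))))) ⟩
      α (⊤ · x · T ^ suc n)  ∎

lemma7 : ∀ {c ℓ a ℓ₁ ℓ₂ s} (K : TopKAT c ℓ) → StarContinuous K →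
         (D : TopKleeneAbsDomain K a ℓ₁ ℓ₂) →
         (Σ′ B : Set s) (u : Atom Σ′ B → TopKAT.Carrier K) → IsInterpretation K u →
         (t : Term Σ′ B) (x : TopKAT.Carrier K) →
         (∀ b → Occurs b t → GloballyComplete K D (u b)) →
         Poset._≈_ (TopKleeneAbsDomain.poset D)
           (S♯ K D u t (TopKleeneAbsDomain.α D (TopKAT._·_ K (TopKAT.⊤ K) x)))
           (TopKleeneAbsDomain.α D (TopKAT._·_ K (TopKAT._·_ K (TopKAT.⊤ K) x) (⟦_⟧ K t u)))
-- Atoms of B need not be interpreted as tests for this result.
lemma7 K sc D Σ′ B u _ t x complete = AbstractSemantics.S♯-α-⊤ sc D u t complete x
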